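{- Let $m$ be a non-negative integer and let $G$ be a connected graph on $n\ge 2m+2$ vertices that has no matching of size $m+1$. Then there exists a vertex $u$ of $G$ such that $G\setminus\{u\}$ has no matching of size $m$. -}

module Defs where

open import Level using (Level; _⊔_; suc)
open import Data.Nat using (ℕ)
open import Data.Fin using (Fin)
open import Data.Product using (Σ; _×_; _,_; proj₁; proj₂)
open import Data.Sum using (_⊎_; inj₁; inj₂)
open import Data.List using (List; []; _∷_)
open import Relation.Nullary using (¬_; Dec)
open import Relation.Binary.PropositionalEquality using (_≡_)
open import Function.Definitions using (Injective)

-- A finite simple graph on the vertex set Fin n (adjacency is decidable, as for any
-- finite graph given by its edge set).
record Graph (n : ℕ) : Set₁ where
  field
    Adj     : Fin n → Fin n → Set
    sym     : ∀ {u v} → Adj u v → Adj v u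
    irrefl  : ∀ {u} → ¬ Adj u u
    adj?    : ∀ u v → Dec (Adj u v)

open Graph public

data Walk {n : ℕ} (G : Graph n) : Fin n → Fin n → Set where
  here : ∀ {u} → Walk G u u
  step : ∀ {u w v} → Adj G u w → Walk G w v → Walk G u v

Connected : ∀ {n} → Graph n → Set
Connected G = ∀ u v → Walk G u v

endpoints : ∀ {n k} → (Fin k → Fin n × Fin n) → Fin k ⊎ Fin k → Fin n
endpoints e (inj₁ i) = proj₁ (e i)
endpoints e (inj₂ i) = proj₂ (e i)

record Matching {n : ℕ} (G : Graph n) (k : ℕ) : Set where
  field
    edge     : Fin k → Fin n × Fin n
    isEdge   : ∀ i → Adj G (proj₁ (edge i)) (proj₂ (edge i))
    disjoint : Injective _≡_ _≡_ (endpoints edge)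

open Matching public

-- A matching of size k in G ∖ {u}: a matching of G none of whose endpoints is u.
-- (Matchings of the vertex-deleted subgraph G ∖ {u} are exactly these.)
record MatchingAvoiding {n : ℕ} (G : Graph n) (u : Fin n) (k : ℕ) : Set where
  field
    matching : Matching G k
    avoids   : ∀ x → ¬ endpoints (edge matching) x ≡ u

-- If every m-matching covers some vertex we are
-- done; otherwise take an m-matching M, which misses two distinct vertices u and v as
-- n ≥ 2m + 2, and follow a walk from u to v. At its next vertex w, either every
-- m-matching covers w, or some m-matching N misses w. In the latter case the
-- alternating path of M and N from w is not augmenting, as there is no (m+1)-matching,
-- and switching M along it gives an m-matching missing w and every vertex missed by M
-- except the far end of the path. If that matching still misses u, the edge uw augments
-- it; otherwise it misses w and v and the walk continues from w. At the last step the
-- edge into v would augment, so the walk stops at a vertex covered by every m-matching.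
-- The switch is built by induction on the number of edges of M missing from N.
module Submission where

open import Defs hiding (sym)
open import Data.Nat using (ℕ; zero; suc; _+_; _*_; _^_; _≤_; _<_; z≤n; s≤s)
open import Data.Nat.Properties using (m≤n⇒m≤1+n; m<n⇒m<1+n; <⇒≱; +-comm; +-identityʳ)
open import Data.Nat.Induction using (<-wellFounded)
open import Data.Fin using (Fin; zero; suc; _≟_; join; splitAt; punchIn; finToFun; funToFin)
open import Data.Fin.Properties
  using (any?; all?; injective⇒≤; splitAt-join; punchIn-injective; punchInᵢ≢i; finToFun-funToFin)
open import Data.Product using (Σ; ∃; _×_; _,_; proj₁; proj₂; curry)
open import Data.Sum using (_⊎_; inj₁; inj₂; swap; reduce; [_,_]; [_,_]′; map)
open import Data.Sum.Properties using (swap-involutive; ≡-dec)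
open import Function using (_∘_; id; _⇔_; mk⇔; Equivalence)
open import Function.Definitions using (Injective)
open import Induction.WellFounded using (Acc; acc)
open import Relation.Nullary using (¬_; Dec; yes; no; contradiction)
open import Relation.Nullary.Decidable using (map′; ¬?; _×-dec_; _⊎-dec_; _→-dec_)
open import Relation.Binary.PropositionalEquality
  using (_≡_; _≢_; _≗_; refl; sym; trans; cong; cong₂; subst; subst₂; ≢-sym)

Slot : ℕ → Set
Slot k = Fin k ⊎ Fin k

_≟ˢ_ : ∀ {k} (x y : Slot k) → Dec (x ≡ y)
_≟ˢ_ = ≡-dec _≟_ _≟_

swap-≢ : ∀ {k} (x : Slot k) → swap x ≢ x
swap-≢ (inj₁ _) ()
swap-≢ (inj₂ _) ()

all⊎? : ∀ {k} {P : Slot k → Set} → (∀ x → Dec (P x)) → Dec (∀ x → P x)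
all⊎? P? = map′ (λ (h₁ , h₂) → [ h₁ , h₂ ]) (λ h → h ∘ inj₁ , h ∘ inj₂)
                (all? (P? ∘ inj₁) ×-dec all? (P? ∘ inj₂))

any⊎? : ∀ {k} {P : Slot k → Set} → (∀ x → Dec (P x)) → Dec (∃ P)
any⊎? P? = map′ [ (λ (i , p) → inj₁ i , p) , (λ (i , p) → inj₂ i , p) ]
                (λ { (inj₁ i , p) → inj₁ (i , p) ; (inj₂ i , p) → inj₂ (i , p) })
                (any? (P? ∘ inj₁) ⊎-dec any? (P? ∘ inj₂))

join-injective : ∀ k {x y : Slot k} → join k k x ≡ join k k y → x ≡ y
join-injective k {x} {y} e =
  trans (sym (splitAt-join k k x)) (trans (cong (splitAt k) e) (splitAt-join k k y))

count : ∀ {k} {P : Fin k → Set} → (∀ i → Dec (P i)) → ℕ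
count {zero}  _  = 0
count {suc _} P? with P? zero
... | yes _ = suc (count (P? ∘ suc))
... | no  _ = count (P? ∘ suc)

count-mono : ∀ {k} {P Q : Fin k → Set} (P? : ∀ i → Dec (P i)) (Q? : ∀ i → Dec (Q i)) →
             (∀ {i} → P i → Q i) → count P? ≤ count Q?
count-mono {zero}  _  _  _   = z≤n
count-mono {suc _} P? Q? P⊆Q with P? zero | Q? zero
... | yes _ | yes _  = s≤s (count-mono (P? ∘ suc) (Q? ∘ suc) P⊆Q)
... | yes p | no ¬q  = contradiction (P⊆Q p) ¬q
... | no _  | yes _  = m≤n⇒m≤1+n (count-mono (P? ∘ suc) (Q? ∘ suc) P⊆Q)
... | no _  | no _   = count-mono (P? ∘ suc) (Q? ∘ suc) P⊆Q

count-< : ∀ {k} {P Q : Fin k → Set} (P? : ∀ i → Dec (P i)) (Q? : ∀ i → Dec (Q i)) →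
          (∀ {i} → P i → Q i) → ∀ {j} → ¬ P j → Q j → count P? < count Q?
count-< {suc _} P? Q? P⊆Q {zero} ¬pⱼ qⱼ with P? zero | Q? zero
... | yes p | _     = contradiction p ¬pⱼ
... | no _  | yes _ = s≤s (count-mono (P? ∘ suc) (Q? ∘ suc) P⊆Q)
... | no _  | no ¬q = contradiction qⱼ ¬q
count-< {suc _} P? Q? P⊆Q {suc j} ¬pⱼ qⱼ with P? zero | Q? zero
... | yes _ | yes _ = s≤s (count-< (P? ∘ suc) (Q? ∘ suc) P⊆Q ¬pⱼ qⱼ)
... | yes p | no ¬q = contradiction (P⊆Q p) ¬q
... | no _  | yes _ = m<n⇒m<1+n (count-< (P? ∘ suc) (Q? ∘ suc) P⊆Q ¬pⱼ qⱼ)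
... | no _  | no _  = count-< (P? ∘ suc) (Q? ∘ suc) P⊆Q ¬pⱼ qⱼ

edgesFrom : ∀ {n k} → (Slot k → Fin n) → Fin k → Fin n × Fin n
edgesFrom f i = f (inj₁ i) , f (inj₂ i)

endpoints-edgesFrom : ∀ {n k} (f : Slot k → Fin n) → endpoints (edgesFrom f) ≗ f
endpoints-edgesFrom f (inj₁ _) = refl
endpoints-edgesFrom f (inj₂ _) = refl

decodeEdges : ∀ {n k} → Fin (n ^ k) → Fin (n ^ k) → Fin k → Fin n × Fin n
decodeEdges i j l = finToFun i l , finToFun j l

endpoints-resp : ∀ {n k} {e e′ : Fin k → Fin n × Fin n} → e ≗ e′ → endpoints e ≗ endpoints e′
endpoints-resp e≗e′ (inj₁ i) = cong proj₁ (e≗e′ i)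
endpoints-resp e≗e′ (inj₂ i) = cong proj₂ (e≗e′ i)

module _ {n : ℕ} {G : Graph n} where

  ends : ∀ {k} → Matching G k → Slot k → Fin n
  ends M = endpoints (edge M)

  Exposed : ∀ {k} → Matching G k → Fin n → Set
  Exposed M t = ∀ x → ends M x ≢ t

  Matched : ∀ {k} → Matching G k → Fin n → Fin n → Set
  Matched M a b = ∃ λ x → ends M x ≡ a × ends M (swap x) ≡ b

  ends-adjacent : ∀ {k} (M : Matching G k) x → Adj G (ends M x) (ends M (swap x))
  ends-adjacent M (inj₁ i) = isEdge M i
  ends-adjacent M (inj₂ i) = Graph.sym G (isEdge M i)

  matched-adjacent : ∀ {k} (M : Matching G k) {a b} → Matched M a b → Adj G a b
  matched-adjacent M (x , refl , refl) = ends-adjacent M x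

  matched-sym : ∀ {k} (M : Matching G k) {a b} → Matched M a b → Matched M b a
  matched-sym M (x , refl , refl) = swap x , refl , cong (ends M) (swap-involutive x)

  matched-functional : ∀ {k} (M : Matching G k) {a b c} → Matched M a b → Matched M a c → b ≡ c
  matched-functional M (x , refl , refl) (y , y↦x , refl) with disjoint M {y} {x} y↦x
  ... | refl = refl

  matched-≢-exposed : ∀ {k} (M : Matching G k) {a b t} → Matched M a b → Exposed M t → a ≢ t
  matched-≢-exposed M (x , x↦a , _) M∌t a≡t = M∌t x (trans x↦a a≡t)

  mate-or-exposed : ∀ {k} (M : Matching G k) a → (∃ λ b → Matched M a b) ⊎ Exposed M a
  mate-or-exposed M a with any⊎? (λ x → ends M x ≟ a)
  ... | yes (x , x↦a) = inj₁ (ends M (swap x) , x , x↦a , refl)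
  ... | no  uncovered = inj₂ (curry uncovered)

  exposed? : ∀ {k} (M : Matching G k) t → Dec (Exposed M t)
  exposed? M t = [ (λ (_ , t─b) → no (λ M∌t → matched-≢-exposed M t─b M∌t refl)) , yes ]′
                   (mate-or-exposed M t)

  matched? : ∀ {k} (M : Matching G k) a b → Dec (Matched M a b)
  matched? M a b = any⊎? (λ x → (ends M x ≟ a) ×-dec (ends M (swap x) ≟ b))

  IsAvoidingMatching : ∀ {k} → Fin n → (Fin k → Fin n × Fin n) → Set
  IsAvoidingMatching w e = (∀ i → Adj G (proj₁ (e i)) (proj₂ (e i)))
                         × (∀ x y → endpoints e x ≡ endpoints e y → x ≡ y)
                         × (∀ x → endpoints e x ≢ w)

  isAvoidingMatching? : ∀ {k} w (e : Fin k → Fin n × Fin n) → Dec (IsAvoidingMatching w e)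
  isAvoidingMatching? w e =
    all? (λ i → adj? G _ _)
    ×-dec all⊎? (λ x → all⊎? (λ y → (endpoints e x ≟ endpoints e y) →-dec (x ≟ˢ y)))
    ×-dec all⊎? (λ x → ¬? (endpoints e x ≟ w))

  isAvoidingMatching-resp : ∀ {k w} {e e′ : Fin k → Fin n × Fin n} → e ≗ e′ →
                            IsAvoidingMatching w e → IsAvoidingMatching w e′
  isAvoidingMatching-resp {e = e} {e′} e≗e′ (adjacent , injective , avoids) =
    (λ i → subst (λ p → Adj G (proj₁ p) (proj₂ p)) (e≗e′ i) (adjacent i)) ,
    (λ x y e′x≡e′y → injective x y (trans (ends≗ x) (trans e′x≡e′y (sym (ends≗ y))))) ,
    (λ x → avoids x ∘ trans (ends≗ x))
    where
      ends≗ : endpoints e ≗ endpoints e′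
      ends≗ = endpoints-resp e≗e′

  -- Exhaustive search: the edge functions are enumerated through Fin (n ^ k).
  matchingAvoiding? : ∀ {k} w → Dec (MatchingAvoiding G w k)
  matchingAvoiding? w =
    map′ (λ (i , j , adjacent , injective , avoids) → record
            { matching = record { edge = decodeEdges i j ; isEdge = adjacent ; disjoint = injective _ _ }
            ; avoids   = avoids })
         (λ N → let e = edge (MatchingAvoiding.matching N) in
           funToFin (proj₁ ∘ e) , funToFin (proj₂ ∘ e) ,
           isAvoidingMatching-resp
             (λ i → sym (cong₂ _,_ (finToFun-funToFin (proj₁ ∘ e) i) (finToFun-funToFin (proj₂ ∘ e) i)))
             (isEdge (MatchingAvoiding.matching N) ,
              (λ _ _ → disjoint (MatchingAvoiding.matching N)) ,
              MatchingAvoiding.avoids N))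
         (any? λ i → any? λ j → isAvoidingMatching? w (decodeEdges i j))

  fromEnds : ∀ {k} (f : Slot k → Fin n) → (∀ x → Adj G (f x) (f (swap x))) →
             Injective _≡_ _≡_ f → Matching G k
  fromEnds f adjacent injective = record
    { edge     = edgesFrom f
    ; isEdge   = adjacent ∘ inj₁
    ; disjoint = λ {x} {y} e →
        injective (trans (sym (endpoints-edgesFrom f x)) (trans e (endpoints-edgesFrom f y)))
    }

  exposed-≗ : ∀ {k} (M : Matching G k) {f : Slot k → Fin n} {t} → ends M ≗ f →
              (∀ x → f x ≢ t) → Exposed M t
  exposed-≗ M M≗f f≢t x e = f≢t x (trans (sym (M≗f x)) e)

  matched-≗ : ∀ {k} (M : Matching G k) {f : Slot k → Fin n} {a b} → ends M ≗ f →
              (∃ λ x → f x ≡ a × f (swap x) ≡ b) → Matched M a b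
  matched-≗ M M≗f (x , x↦a , sx↦b) = x , trans (M≗f x) x↦a , trans (M≗f (swap x)) sx↦b

  module _ {k} (M : Matching G k) {a b} (a~b : Adj G a b) (M∌a : Exposed M a) (M∌b : Exposed M b)
    where

    private
      ends⁺ : Slot (suc k) → Fin n
      ends⁺ (inj₁ zero)    = a
      ends⁺ (inj₂ zero)    = b
      ends⁺ (inj₁ (suc i)) = ends M (inj₁ i)
      ends⁺ (inj₂ (suc i)) = ends M (inj₂ i)

      ends⁺-adjacent : ∀ x → Adj G (ends⁺ x) (ends⁺ (swap x))
      ends⁺-adjacent (inj₁ zero)    = a~b
      ends⁺-adjacent (inj₂ zero)    = Graph.sym G a~b
      ends⁺-adjacent (inj₁ (suc i)) = ends-adjacent M (inj₁ i)
      ends⁺-adjacent (inj₂ (suc i)) = ends-adjacent M (inj₂ i)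

      a≢b : a ≢ b
      a≢b refl = Graph.irrefl G a~b

      ends⁺-injective : Injective _≡_ _≡_ ends⁺
      ends⁺-injective {inj₁ zero}    {inj₁ zero}    _ = refl
      ends⁺-injective {inj₂ zero}    {inj₂ zero}    _ = refl
      ends⁺-injective {inj₁ zero}    {inj₂ zero}    e = contradiction e a≢b
      ends⁺-injective {inj₂ zero}    {inj₁ zero}    e = contradiction (sym e) a≢b
      ends⁺-injective {inj₁ zero}    {inj₁ (suc j)} e = contradiction (sym e) (M∌a (inj₁ j))
      ends⁺-injective {inj₁ zero}    {inj₂ (suc j)} e = contradiction (sym e) (M∌a (inj₂ j))
      ends⁺-injective {inj₂ zero}    {inj₁ (suc j)} e = contradiction (sym e) (M∌b (inj₁ j))
      ends⁺-injective {inj₂ zero}    {inj₂ (suc j)} e = contradiction (sym e) (M∌b (inj₂ j))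
      ends⁺-injective {inj₁ (suc i)} {inj₁ zero}    e = contradiction e (M∌a (inj₁ i))
      ends⁺-injective {inj₂ (suc i)} {inj₁ zero}    e = contradiction e (M∌a (inj₂ i))
      ends⁺-injective {inj₁ (suc i)} {inj₂ zero}    e = contradiction e (M∌b (inj₁ i))
      ends⁺-injective {inj₂ (suc i)} {inj₂ zero}    e = contradiction e (M∌b (inj₂ i))
      ends⁺-injective {inj₁ (suc i)} {inj₁ (suc j)} e = cong (map suc suc) (disjoint M {inj₁ i} {inj₁ j} e)
      ends⁺-injective {inj₁ (suc i)} {inj₂ (suc j)} e = cong (map suc suc) (disjoint M {inj₁ i} {inj₂ j} e)
      ends⁺-injective {inj₂ (suc i)} {inj₁ (suc j)} e = cong (map suc suc) (disjoint M {inj₂ i} {inj₁ j} e)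
      ends⁺-injective {inj₂ (suc i)} {inj₂ (suc j)} e = cong (map suc suc) (disjoint M {inj₂ i} {inj₂ j} e)

    extend : Matching G (suc k)
    extend = fromEnds ends⁺ ends⁺-adjacent ends⁺-injective

  module Retarget {k} (M : Matching G k) (x : Slot k) {c} (c~ : Adj G c (ends M (swap x)))
                  (M∌c : Exposed M c) where

    retarget : Slot k → Fin n
    retarget y with y ≟ˢ x
    ... | yes _ = c
    ... | no  _ = ends M y

    retarget-spec : ∀ y → (y ≡ x × retarget y ≡ c) ⊎ (y ≢ x × retarget y ≡ ends M y)
    retarget-spec y with y ≟ˢ x
    ... | yes y≡x = inj₁ (y≡x , refl)
    ... | no  y≢x = inj₂ (y≢x , refl)

    retarget-at : retarget x ≡ c
    retarget-at with retarget-spec x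
    ... | inj₁ (_ , r)   = r
    ... | inj₂ (x≢x , _) = contradiction refl x≢x

    retarget-elsewhere : ∀ {y} → y ≢ x → retarget y ≡ ends M y
    retarget-elsewhere {y} y≢x with retarget-spec y
    ... | inj₁ (y≡x , _) = contradiction y≡x y≢x
    ... | inj₂ (_ , r)   = r

    retarget-adjacent : ∀ y → Adj G (retarget y) (retarget (swap y))
    retarget-adjacent y with retarget-spec y | retarget-spec (swap y)
    ... | inj₁ (refl , _) | inj₁ (sx≡x , _) = contradiction sx≡x (swap-≢ x)
    ... | inj₁ (refl , r) | inj₂ (_ , r′)   = subst₂ (Adj G) (sym r) (sym r′) c~
    ... | inj₂ (_ , r)    | inj₁ (sy≡x , r′) =
      subst₂ (Adj G) (sym r) (sym r′)
        (subst (λ z → Adj G (ends M z) c) (sym y≡sx) (Graph.sym G c~))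
      where
        y≡sx : y ≡ swap x
        y≡sx = trans (sym (swap-involutive y)) (cong swap sy≡x)
    ... | inj₂ (_ , r)    | inj₂ (_ , r′)   = subst₂ (Adj G) (sym r) (sym r′) (ends-adjacent M y)

    retarget-injective : Injective _≡_ _≡_ retarget
    retarget-injective {y} {z} e with retarget-spec y | retarget-spec z
    ... | inj₁ (refl , _) | inj₁ (refl , _) = refl
    ... | inj₁ (refl , r) | inj₂ (_ , r′)   = contradiction (trans (sym r′) (trans (sym e) r)) (M∌c z)
    ... | inj₂ (_ , r)    | inj₁ (refl , r′) = contradiction (trans (sym r) (trans e r′)) (M∌c y)
    ... | inj₂ (_ , r)    | inj₂ (_ , r′)   = disjoint M (trans (sym r) (trans e r′))

    retarget-≢-old : ∀ y → retarget y ≢ ends M x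
    retarget-≢-old y e with retarget-spec y
    ... | inj₁ (_ , r)   = M∌c x (trans (sym e) r)
    ... | inj₂ (y≢x , r) = y≢x (disjoint M (trans (sym r) e))

    retarget-≢-exposed : ∀ {t} → Exposed M t → t ≢ c → ∀ y → retarget y ≢ t
    retarget-≢-exposed M∌t t≢c y e with retarget-spec y
    ... | inj₁ (_ , r) = t≢c (trans (sym e) r)
    ... | inj₂ (_ , r) = M∌t y (trans (sym r) e)

  record Rematch {k} (M : Matching G k) (a b c : Fin n) : Set where
    field
      matching      : Matching G k
      exposes       : Exposed matching a
      matches       : Matched matching c b
      keeps-exposed : ∀ {t} → Exposed M t → t ≢ c → Exposed matching t
      keeps-matched : ∀ {s t} → Matched M s t → s ≢ a → t ≢ a → Matched matching s t

  rematch : ∀ {k} (M : Matching G k) {a b c} → Matched M a b → Adj G c b → Exposed M c →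
            Rematch M a b c
  rematch M (x , refl , refl) c~b M∌c = record
    { matching      = M′
    ; exposes       = exposed-≗ M′ M′≗ retarget-≢-old
    ; matches       = matched-≗ M′ M′≗ (x , retarget-at , retarget-elsewhere (swap-≢ x))
    ; keeps-exposed = λ M∌t t≢c → exposed-≗ M′ M′≗ (retarget-≢-exposed M∌t t≢c)
    ; keeps-matched = λ { (y , refl , refl) s≢a t≢a →
        matched-≗ M′ M′≗ (y , retarget-elsewhere {y} (s≢a ∘ cong (ends M))
                            , retarget-elsewhere {swap y} (t≢a ∘ cong (ends M))) }
    }
    where
      open Retarget M x c~b M∌c
      M′ : Matching G _
      M′ = fromEnds retarget retarget-adjacent retarget-injective
      M′≗ : ends M′ ≗ retarget
      M′≗ = endpoints-edgesFrom retarget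

  Agrees : ∀ {k} → Matching G k → Matching G k → Fin k → Set
  Agrees M N i = Matched N (ends M (inj₁ i)) (ends M (inj₂ i))

  agrees⇔matched : ∀ {k} (M N : Matching G k) x →
                   Agrees M N (reduce x) ⇔ Matched N (ends M x) (ends M (swap x))
  agrees⇔matched M N (inj₁ _) = mk⇔ id id
  agrees⇔matched M N (inj₂ _) = mk⇔ (matched-sym N) (matched-sym N)

  disagrees? : ∀ {k} (M N : Matching G k) i → Dec (¬ Agrees M N i)
  disagrees? M N i = ¬? (matched? N (ends M (inj₁ i)) (ends M (inj₂ i)))

  disagreement : ∀ {k} → Matching G k → Matching G k → ℕ
  disagreement M N = count (disagrees? M N)

  disagreement-< : ∀ {k} (M N N′ : Matching G k) →
                   (∀ {a b} → Matched M a b → Matched N a b → Matched N′ a b) →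
                   ∀ {a b} → Matched M a b → Matched N′ a b → ¬ Matched N a b →
                   disagreement M N′ < disagreement M N
  disagreement-< M N N′ keep (x , refl , refl) N′ab ¬Nab =
    count-< (disagrees? M N′) (disagrees? M N) (λ ¬N′ᵢ Nᵢ → ¬N′ᵢ (keep (inj₁ _ , refl , refl) Nᵢ))
            (λ ¬N′ⱼ → ¬N′ⱼ (Equivalence.from (agrees⇔matched M N′ x) N′ab))
            (¬Nab ∘ Equivalence.to (agrees⇔matched M N x))

  -- M switched along the alternating path of M and N starting at w; `sacrificed` is the
  -- far end of that path.
  record Exchange {k} (M N : Matching G k) (w : Fin n) : Set where
    field
      matching      : Matching G k
      exposes       : Exposed matching w
      sacrificed    : Fin n
      keeps-exposed : ∀ {t} → Exposed M t → t ≢ sacrificed → Exposed matching t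
      keeps-shared  : ∀ {a b} → Matched M a b → Matched N a b → Matched matching a b

  exchange-id : ∀ {k} {M N : Matching G k} {w} → Exposed M w → Exchange M N w
  exchange-id {M = M} {w = w} M∌w = record
    { matching = M ; exposes = M∌w ; sacrificed = w
    ; keeps-exposed = λ M∌t _ → M∌t ; keeps-shared = λ Mab _ → Mab }

  exchange-direct : ∀ {k} (M N : Matching G k) {w x₁ x₂} →
    Matched M w x₁ → Matched N x₁ x₂ → Exposed M x₂ → Exposed N w → Exchange M N w
  exchange-direct M N w─x₁ x₁─x₂ M∌x₂ N∌w = record
    { matching      = R.matching
    ; exposes       = R.exposes
    ; sacrificed    = _
    ; keeps-exposed = R.keeps-exposed
    ; keeps-shared  = λ Mab Nab →
        R.keeps-matched Mab (matched-≢-exposed N Nab N∌w)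
                            (matched-≢-exposed N (matched-sym N Nab) N∌w)
    }
    where module R = Rematch (rematch M w─x₁ (matched-adjacent N (matched-sym N x₁─x₂)) M∌x₂)

  -- N is rerouted along the alternating path to N₁, which agrees with M on wx₁ and
  -- misses x₂; the exchange of M with N₁ at x₂ then contains wx₁, which is swapped for x₂x₁.
  exchange-reroute : ∀ {k} (M N : Matching G k) {w x₁ x₂ x₃} →
    (∀ N′ → disagreement M N′ < disagreement M N → ∀ {w′} → Exposed N′ w′ → Exchange M N′ w′) →
    Matched M w x₁ → Matched N x₁ x₂ → Matched M x₂ x₃ → Exposed N w → Exchange M N w
  exchange-reroute M N {w} {x₁} {x₂} IH w─x₁ x₁─x₂ x₂─x₃ N∌w = record
    { matching      = R₂.matching
    ; exposes       = R₂.exposes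
    ; sacrificed    = E.sacrificed
    ; keeps-exposed = λ M∌t t≢z →
        R₂.keeps-exposed (E.keeps-exposed M∌t t≢z) (≢-sym (matched-≢-exposed M x₂─x₃ M∌t))
    ; keeps-shared  = λ Mab Nab →
        R₂.keeps-matched (E.keeps-shared Mab (shared-in-N₁ Mab Nab))
                         (matched-≢-exposed N Nab N∌w)
                         (matched-≢-exposed N (matched-sym N Nab) N∌w)
    }
    where
      module R₁ = Rematch (rematch N (matched-sym N x₁─x₂) (matched-adjacent M w─x₁) N∌w)

      shared-≢-x₂ : ∀ {a b} → Matched M a b → Matched N a b → a ≢ x₂
      shared-≢-x₂ Mab Nab refl = matched-≢-exposed N (matched-sym N x₁─x₂) N∌w x₂≡w
        where
          M-x₂─x₁ : Matched M x₂ x₁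
          M-x₂─x₁ = subst (Matched M x₂) (matched-functional N Nab (matched-sym N x₁─x₂)) Mab
          x₂≡w : x₂ ≡ w
          x₂≡w = matched-functional M (matched-sym M M-x₂─x₁) (matched-sym M w─x₁)

      shared-in-N₁ : ∀ {a b} → Matched M a b → Matched N a b → Matched R₁.matching a b
      shared-in-N₁ Mab Nab = R₁.keeps-matched Nab (shared-≢-x₂ Mab Nab)
                               (shared-≢-x₂ (matched-sym M Mab) (matched-sym N Nab))

      module E = Exchange (IH R₁.matching
        (disagreement-< M N R₁.matching shared-in-N₁ w─x₁ R₁.matches
          (λ N-w─x₁ → matched-≢-exposed N N-w─x₁ N∌w refl))
        R₁.exposes)
      module R₂ = Rematch (rematch E.matching (E.keeps-shared w─x₁ R₁.matches)
                            (matched-adjacent N (matched-sym N x₁─x₂)) E.exposes)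

  module _ {k} (noLarger : ¬ Matching G (suc k)) where

    exchange-acc : ∀ (M N : Matching G k) {w} → Acc _<_ (disagreement M N) → Exposed N w →
                   Exchange M N w
    exchange-acc M N {w} (acc rec) N∌w with mate-or-exposed M w
    ... | inj₂ M∌w = exchange-id M∌w
    ... | inj₁ (x₁ , w─x₁) with mate-or-exposed N x₁
    ...   | inj₂ N∌x₁ = contradiction (extend N (matched-adjacent M w─x₁) N∌w N∌x₁) noLarger
    ...   | inj₁ (x₂ , x₁─x₂) with mate-or-exposed M x₂
    ...     | inj₂ M∌x₂ = exchange-direct M N w─x₁ x₁─x₂ M∌x₂ N∌w
    ...     | inj₁ (_ , x₂─x₃) =
      exchange-reroute M N (λ N′ lt → exchange-acc M N′ (rec lt)) w─x₁ x₁─x₂ x₂─x₃ N∌w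

    exchange : ∀ (M N : Matching G k) {w} → Exposed N w → Exchange M N w
    exchange M N = exchange-acc M N (<-wellFounded _)

    unavoidable-on-walk : ∀ {u v} → Walk G u v → (M : Matching G k) →
      Exposed M u → Exposed M v → u ≢ v → ∃ λ w → ¬ MatchingAvoiding G w k
    unavoidable-on-walk here _ _ _ u≢u = contradiction refl u≢u
    unavoidable-on-walk {u} {v} (step {w = w} u~w rest) M M∌u M∌v u≢v with w ≟ v
    ... | yes refl = contradiction (extend M u~w M∌u M∌v) noLarger
    ... | no w≢v with matchingAvoiding? w
    ...   | no ¬N = w , ¬N
    ...   | yes record { matching = N ; avoids = N∌w } with exchange M N N∌w
    ...     | M′ with u ≟ Exchange.sacrificed M′
    ...       | yes refl = unavoidable-on-walk rest (Exchange.matching M′) (Exchange.exposes M′)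
                             (Exchange.keeps-exposed M′ M∌v (≢-sym u≢v)) w≢v
    ...       | no u≢z = contradiction
                  (extend (Exchange.matching M′) u~w (Exchange.keeps-exposed M′ M∌u u≢z)
                          (Exchange.exposes M′))
                  noLarger

exposed-vertex-≢ : ∀ {n k} {G : Graph n} (M : Matching G k) → suc (k + k) < n → (u : Fin n) →
                   ∃ λ t → t ≢ u × Exposed M t
exposed-vertex-≢ {suc n} {k} M (s≤s 2k<n) u with any? (λ t → ¬? (t ≟ u) ×-dec exposed? M t)
... | yes found = found
... | no none = contradiction (injective⇒≤ code-injective) (<⇒≱ 2k<n)
  where
    cover : ∀ i → ∃ λ x → ends M x ≡ punchIn u i
    cover i with mate-or-exposed M (punchIn u i)
    ... | inj₁ (_ , x , x↦t , _) = x , x↦t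
    ... | inj₂ M∌t = contradiction (punchIn u i , punchInᵢ≢i u i , M∌t) none

    code : Fin n → Fin (k + k)
    code i = join k k (proj₁ (cover i))

    code-injective : Injective _≡_ _≡_ code
    code-injective {i} {j} e = punchIn-injective u i j
      (trans (sym (proj₂ (cover i)))
             (trans (cong (ends M) (join-injective k {proj₁ (cover i)} {proj₁ (cover j)} e))
                    (proj₂ (cover j))))

unavoidable-vertex : ∀ {n k} (G : Graph n) → Connected G → suc (k + k) < n →
                     ¬ Matching G (suc k) → ∃ λ u → ¬ MatchingAvoiding G u k
unavoidable-vertex {suc _} G connected 2k+1<n noLarger with matchingAvoiding? zero
... | no ¬N = zero , ¬N
... | yes record { matching = M ; avoids = M∌0 } with exposed-vertex-≢ M 2k+1<n zero
...   | v , v≢0 , M∌v = unavoidable-on-walk noLarger (connected zero v) M M∌0 M∌v (≢-sym v≢0)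

corollary3p6 : (m n : ℕ) → 2 * m + 2 ≤ n → (G : Graph n) → Connected G →
    ¬ Matching G (m + 1) →
    Σ (Fin n) (λ u → ¬ MatchingAvoiding G u m)
corollary3p6 m n 2m+2≤n G connected noLarger =
  unavoidable-vertex G connected (subst (_≤ n) 2m+2≡ 2m+2≤n)
                     (noLarger ∘ subst (Matching G) (+-comm 1 m))
  where
    2m+2≡ : 2 * m + 2 ≡ suc (suc (m + m))
    2m+2≡ = trans (+-comm (2 * m) 2) (cong (λ j → 2 + (m + j)) (+-identityʳ m))
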